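{- There exists a connected graph $G$ with $\operatorname{th}_d(G) \leq \operatorname{th}_c(G) - 3$.
   Context: Cops and Robbers on a finite simple graph with $n$ vertices: in round $0$ each of $k$ cops and then the robber choose a vertex; in each later round each cop stays or moves along an edge, then the robber does the same; capture occurs when a cop occupies the robber's vertex. $\operatorname{capt}_k(G)$ is the minimum number of rounds for $k$ cops to capture a robber who evades as long as possible ($\infty$ if $k$ is less than the cop number). A vertex is damaged if the robber occupies it in a round in which capture does not occur; $\operatorname{dmg}_k(G)$ is the minimum number of damaged vertices over games with $k$ cops when the robber maximizes damage. $\operatorname{th}_c(G)=\min_{1\le k\le n}\{k+\operatorname{capt}_k(G)\}$, $\operatorname{th}_d(G)=\min_{1\le k\le n}\{k+\operatorname{dmg}_k(G)\}$. -}

module Defs where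

open import Data.Nat using (ℕ; zero; suc; _+_; _≤_)
open import Data.Fin using (Fin)
open import Data.Fin.Subset using (Subset; _∈_; ∣_∣)
open import Data.Bool using (Bool; true; false)
open import Data.List using (List; []; _∷_)
open import Data.Product using (Σ; ∃; _×_; _,_)
open import Data.Sum using (_⊎_)
open import Relation.Nullary using (¬_)
open import Relation.Binary.PropositionalEquality using (_≡_)
open import Relation.Binary.Construct.Closure.ReflexiveTransitive using (Star)

record Graph (n : ℕ) : Set where
  field
    adj    : Fin n → Fin n → Bool
    sym    : ∀ u v → adj u v ≡ adj v u
    irrefl : ∀ v → adj v v ≡ false

module _ {n : ℕ} (G : Graph n) where
  open Graph G

  Edge : Fin n → Fin n → Set
  Edge u v = adj u v ≡ true

  Connected : Set
  Connected = ∀ u v → Star Edge u v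

  Step : Fin n → Fin n → Set
  Step u v = u ≡ v ⊎ Edge u v

-- A history is the list of completed rounds (most recent first), each
-- entry being (cop positions, robber position) at the end of that round.
-- Round 0 is the empty history.

module Game {n : ℕ} (G : Graph n) (k : ℕ) where

  Conf : Set
  Conf = Fin k → Fin n

  History : Set
  History = List (Conf × Fin n)

  -- cop strategy: from the history of completed rounds, the cop
  -- positions for the next round (for [] : the initial placement)
  CopStrategy : Set
  CopStrategy = History → Conf

  -- robber strategy: from the history and the cops' new positions,
  -- the robber position for this round
  RobberStrategy : Set
  RobberStrategy = History → Conf → Fin n

  LegalCop : CopStrategy → Set
  LegalCop σ = ∀ h C r → ∀ j → Step G (C j) (σ ((C , r) ∷ h) j)

  LegalRobber : RobberStrategy → Set
  LegalRobber τ = ∀ h C r C' → Step G r (τ ((C , r) ∷ h) C')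

  module Play (σ : CopStrategy) (τ : RobberStrategy) where

    -- histories after i completed rounds (rounds 0 .. i-1)
    run : ℕ → History
    run zero    = []
    run (suc i) = (σ (run i) , τ (run i) (σ (run i))) ∷ run i

    cops : ℕ → Conf
    cops i = σ (run i)

    robber : ℕ → Fin n
    robber i = τ (run i) (cops i)

    Occupied : Conf → Fin n → Set
    Occupied C v = ∃ λ j → C j ≡ v

    -- capture occurs in round i: in round 0 if the robber chooses an
    -- occupied vertex; in round i+1 if a cop moves onto the robber's
    -- vertex, or the robber moves onto a cop's vertex
    CaughtAt : ℕ → Set
    CaughtAt zero    = Occupied (cops zero) (robber zero)
    CaughtAt (suc i) = Occupied (cops (suc i)) (robber i)
                     ⊎ Occupied (cops (suc i)) (robber (suc i))

    CaughtBy : ℕ → Set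
    CaughtBy t = ∃ λ i → i ≤ t × CaughtAt i

    Damaged : Fin n → Set
    Damaged v = ∃ λ i → robber i ≡ v × (∀ j → j ≤ suc i → ¬ CaughtAt j)

  open Play public

  CaptWithin : ℕ → Set
  CaptWithin t = Σ CopStrategy λ σ → LegalCop σ ×
    (∀ τ → LegalRobber τ → CaughtBy σ τ t)

  DmgAtMost : ℕ → Set
  DmgAtMost d = Σ CopStrategy λ σ → LegalCop σ ×
    (∀ τ → LegalRobber τ →
      Σ (Subset n) λ S → ∣ S ∣ ≤ d × (∀ v → Damaged σ τ v → v ∈ S))

-- capt_k(G) = min { t | CaptWithin k t },  dmg_k(G) = min { d | DmgAtMost k d }
-- th_c(G) = min_{1≤k≤n} (k + capt_k(G)) = min { k + t | 1≤k≤n, CaptWithin k t }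
-- (k with capt_k = ∞ contribute nothing to the minimum).

module _ {n : ℕ} (G : Graph n) where

  IsThrottleC : ℕ → Set
  IsThrottleC T =
    (∃ λ k → 1 ≤ k × k ≤ n × ∃ λ t → Game.CaptWithin G k t × k + t ≡ T)
    × (∀ k t → 1 ≤ k → k ≤ n → Game.CaptWithin G k t → T ≤ k + t)

  IsThrottleD : ℕ → Set
  IsThrottleD T =
    (∃ λ k → 1 ≤ k × k ≤ n × ∃ λ d → Game.DmgAtMost G k d × k + d ≡ T)
    × (∀ k d → 1 ≤ k → k ≤ n → Game.DmgAtMost G k d → T ≤ k + d)

module Submission where

-- Two cops on the hubs 0 and 1 guard every vertex except 10, 11, 12, 13, and all neighbours of
-- those four; a robber who starts unguarded is therefore caught as soon as he moves and damages
-- only his start vertex. So th_d ≤ 2 + 1, and th_d = 3 because one cop cannot keep a robber who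
-- moves every round from damaging two vertices, nor can two cops prevent all damage. Capturing
-- costs more: cops on {0,1,2,3,6} dominate the graph and capture in one round, but against k ≤ 4
-- cops the robber survives rounds 0, …, 5 − k from a suitable start (a finite game tree that the
-- type checker evaluates), and five cops cannot occupy all 14 vertices in round 0. Hence th_c = 6.

open import Defs
open import Data.Bool using (Bool; true; false; T; not; _∧_; _∨_; if_then_else_)
open import Data.Bool.Properties using (T-≡; T-not-≡; T-∧; T-∨; ⇔→≡) renaming (_≟_ to _≟ᵇ_)
open import Data.Empty using (⊥-elim)
open import Data.Fin using (Fin; zero; suc; #_)
open import Data.Fin.Properties using (_≟_; all?; any?; ¬∀⟶∃¬; pigeonhole; <⇒≢)
open import Data.Fin.Subset using (Subset; ⁅_⁆; ∣_∣; _-_) renaming (_∈_ to _∈ₛ_)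
open import Data.Fin.Subset.Properties
  using (x∈⁅x⁆; x∈⁅y⁆⇒x≡y; ∣⁅x⁆∣≡1; p⊆q⇒∣p∣≤∣q∣; x∈p⇒∣p-x∣<∣p∣; x∈p∧x≢y⇒x∈p-y)
open import Data.Bool.ListAction using (all; any)
open import Data.List using (List; []; _∷_; length; map; tabulate; allFin)
open import Data.List.Properties using (map-tabulate)
open import Data.List.Membership.Propositional using (_∈_; find)
open import Data.List.Membership.Propositional.Properties using (∈-allFin)
open import Data.List.Relation.Binary.Pointwise using (Pointwise; []; _∷_; tabulate⁺)
open import Data.List.Relation.Unary.Any using (here; there)
import Data.List.Relation.Unary.All as All
import Data.List.Relation.Unary.All.Properties as All
import Data.List.Relation.Unary.Any.Properties as Any
open import Data.Nat using (ℕ; zero; suc; _+_; _∸_; _≤_; _<_; _≤?_; _<?_; z≤n; s≤s)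
open import Data.Nat.Properties
  using (≤-refl; ≤-trans; ≤-reflexive; <-≤-trans; ≰⇒>; m≤n⇒m≤1+n; m≤n⇒m<n∨m≡n;
         m≤m+n; +-monoʳ-≤; +-suc; n∸n≡0; m+n∸m≡n; m+[n∸m]≡n)
open import Data.Product using (Σ; ∃; _×_; _,_; proj₁; proj₂; map₁)
open import Data.Sum using (_⊎_; inj₁; inj₂)
import Data.Sum as Sum
open import Data.Vec using (Vec; []; _∷_; lookup)
open import Function using (_∘_; Equivalence; mk⇔)
open import Relation.Binary.Construct.Closure.ReflexiveTransitive using (Star; ε; _◅_; _◅◅_; reverse)
open import Relation.Binary.PropositionalEquality using (_≡_; _≢_; refl; sym; trans; cong; subst; subst₂)
open import Relation.Nullary using (¬_; Dec; yes; no; does)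
open import Relation.Nullary.Decidable using (⌊_⌋; toWitness; toWitnessFalse; fromWitness; from-yes; dec-true; dec-false; _⊎-dec_; _→-dec_)

all-allFin : ∀ {n} (p : Fin n → Bool) → T (all p (allFin n)) → ∀ v → T (p v)
all-allFin p h = All.tabulate⁻ (All.all⁺ p _ h)

any-witness : ∀ {A : Set} (p : A → Bool) xs → T (any p xs) → ∃ λ x → x ∈ xs × T (p x)
any-witness p xs h = find (Any.any⁻ p xs h)

allChoices : {A : Set} → List (List A) → (List A → Bool) → Bool
allChoices []         P = P []
allChoices (xs ∷ xss) P = all (λ x → allChoices xss (P ∘ (x ∷_))) xs

allChoices-sound : ∀ {A : Set} {xss : List (List A)} {ys} (P : List A → Bool) →
                   T (allChoices xss P) → Pointwise _∈_ ys xss → T (P ys)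
allChoices-sound P h [] = h
allChoices-sound {xss = xs ∷ _} {y ∷ _} P h (y∈xs ∷ rest) =
  allChoices-sound (P ∘ (y ∷_)) (All.lookup (All.all⁺ _ xs h) y∈xs) rest

firstOr : {A : Set} → A → (A → Bool) → List A → A
firstOr d p []       = d
firstOr d p (x ∷ xs) = if p x then x else firstOr d p xs

firstOr-∈ : ∀ {A : Set} (d : A) p xs → T (any p xs) → firstOr d p xs ∈ xs × T (p (firstOr d p xs))
firstOr-∈ d p (x ∷ xs) h with p x in px
... | true  = here refl , Equivalence.from T-≡ px
... | false = map₁ there (firstOr-∈ d p xs h)

firstOr-∈⊎≡ : ∀ {A : Set} (d : A) p xs → firstOr d p xs ∈ xs ⊎ firstOr d p xs ≡ d
firstOr-∈⊎≡ d p []       = inj₂ refl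
firstOr-∈⊎≡ d p (x ∷ xs) with p x
... | true  = inj₁ (here refl)
... | false = Sum.map₁ there (firstOr-∈⊎≡ d p xs)

x∈p⇒0<∣p∣ : ∀ {n} {p : Subset n} {x} → x ∈ₛ p → 0 < ∣ p ∣
x∈p⇒0<∣p∣ {x = x} x∈p =
  subst (_≤ _) (∣⁅x⁆∣≡1 x) (p⊆q⇒∣p∣≤∣q∣ λ y∈⁅x⁆ → subst (_∈ₛ _) (sym (x∈⁅y⁆⇒x≡y x y∈⁅x⁆)) x∈p)

x∈p∧y∈p∧x≢y⇒1<∣p∣ : ∀ {n} {p : Subset n} {x y} → x ∈ₛ p → y ∈ₛ p → x ≢ y → 1 < ∣ p ∣
x∈p∧y∈p∧x≢y⇒1<∣p∣ x∈p y∈p x≢y =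
  ≤-trans (s≤s (x∈p⇒0<∣p∣ (x∈p∧x≢y⇒x∈p-y y∈p (x≢y ∘ sym)))) (x∈p⇒∣p-x∣<∣p∣ x∈p)

module _ {n : ℕ} (G : Graph n) where
  open Graph G renaming (sym to adj-sym)

  step? : ∀ u v → Dec (Step G u v)
  step? u v = (u ≟ v) ⊎-dec (adj u v ≟ᵇ true)

  edge? : ∀ u v → Dec (Edge G u v)
  edge? u v = adj u v ≟ᵇ true

  edge⇒≢ : ∀ {u v} → Edge G u v → u ≢ v
  edge⇒≢ {u} e refl with trans (sym (irrefl u)) e
  ... | ()

  connected-via : (root : Fin n) → (∀ u → Star (Edge G) u root) → Connected G
  connected-via root path u v = path u ◅◅ reverse (λ {a} {b} e → trans (adj-sym b a) e) (path v)

module AdjacencyList {n : ℕ} (nbrs : Fin n → List (Fin n)) where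
  open import Data.List.Membership.DecPropositional (_≟_ {n}) using (_∈?_)

  adjacent : Fin n → Fin n → Bool
  adjacent u v = ⌊ v ∈? nbrs u ⌋

  ∈⇒adjacent : ∀ {u v} → v ∈ nbrs u → adjacent u v ≡ true
  ∈⇒adjacent {u} {v} v∈ = Equivalence.to T-≡ (fromWitness {a? = v ∈? nbrs u} v∈)

  adjacent⇒∈ : ∀ {u v} → adjacent u v ≡ true → v ∈ nbrs u
  adjacent⇒∈ {u} {v} e = toWitness {a? = v ∈? nbrs u} (Equivalence.from T-≡ e)

  symmetric? : Bool
  symmetric? = all (λ u → all (λ v → adjacent v u) (nbrs u)) (allFin n)

  symmetric?-sound : T symmetric? → ∀ u v → adjacent u v ≡ adjacent v u
  symmetric?-sound h u v = ⇔→≡ (mk⇔ (back u v) (back v u))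
    where
      back : ∀ u v → adjacent u v ≡ true → adjacent v u ≡ true
      back u v e = Equivalence.to T-≡ (All.lookup (All.all⁺ _ _ (all-allFin _ h u)) (adjacent⇒∈ e))

  irreflexive? : Bool
  irreflexive? = all (λ v → not (adjacent v v)) (allFin n)

  irreflexive?-sound : T irreflexive? → ∀ v → adjacent v v ≡ false
  irreflexive?-sound h v = Equivalence.to T-not-≡ (all-allFin _ h v)

  reaches : ℕ → Fin n → Fin n → Bool
  reaches zero    u w = ⌊ u ≟ w ⌋
  reaches (suc f) u w = ⌊ u ≟ w ⌋ ∨ any (λ v → reaches f v w) (nbrs u)

  reaches-sound : ∀ f u w → T (reaches f u w) → Star (λ a b → adjacent a b ≡ true) u w
  reaches-sound zero u w h = subst (Star _ u) (toWitness {a? = u ≟ w} h) ε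
  reaches-sound (suc f) u w h with Equivalence.to T-∨ h
  ... | inj₁ u≡w = subst (Star _ u) (toWitness {a? = u ≟ w} u≡w) ε
  ... | inj₂ h′ with any-witness _ (nbrs u) h′
  ...   | v , v∈ , r = ∈⇒adjacent v∈ ◅ reaches-sound f v w r

module GameFacts {n : ℕ} (G : Graph n) (k : ℕ) where
  open Game G k

  Survives : RobberStrategy → ℕ → Set
  Survives τ m = ∀ σ → LegalCop σ → ∀ i → i ≤ m → ¬ CaughtAt σ τ i

  CanSurvive : ℕ → Set
  CanSurvive m = ∃ λ τ → LegalRobber τ × Survives τ m

  capt-lower-bound : ∀ {m t} → CanSurvive m → CaptWithin t → m < t
  capt-lower-bound (τ , τ-legal , survives) (σ , σ-legal , wins) with wins τ τ-legal
  ... | i , i≤t , caught = <-≤-trans (≰⇒> λ i≤m → survives σ σ-legal i i≤m caught) i≤t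

  survives⇒damaged : ∀ {τ m} → Survives τ (suc m) →
                     ∀ σ → LegalCop σ → ∀ i → i ≤ m → Damaged σ τ (robber σ τ i)
  survives⇒damaged survives σ σ-legal i i≤m =
    i , refl , λ j j≤1+i → survives σ σ-legal j (≤-trans j≤1+i (s≤s i≤m))

  length-run : ∀ σ τ i → length (run σ τ i) ≡ i
  length-run σ τ zero    = refl
  length-run σ τ (suc i) = cong suc (length-run σ τ i)

  unoccupied : k < n → (C : Conf) → ∃ λ v → ¬ ∃ λ j → C j ≡ v
  unoccupied k<n C = ¬∀⟶∃¬ n _ (λ v → any? λ j → C j ≟ v) covers⇒⊥
    where
      covers⇒⊥ : ¬ (∀ v → ∃ λ j → C j ≡ v)
      covers⇒⊥ cover with pigeonhole k<n (proj₁ ∘ cover)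
      ... | u , v , u<v , same =
        <⇒≢ u<v (trans (sym (proj₂ (cover u))) (trans (cong C same) (proj₂ (cover v))))

  survives-round-zero : k < n → CanSurvive 0
  survives-round-zero k<n = τ , (λ _ _ _ _ → inj₁ refl) , survives
    where
      τ : RobberStrategy
      τ []            C = proj₁ (unoccupied k<n C)
      τ ((_ , r) ∷ _) _ = r

      survives : Survives τ 0
      survives σ _ zero z≤n = proj₂ (unoccupied k<n (cops σ τ zero))

module Guards {n : ℕ} (G : Graph n) {k : ℕ} (posts : Fin k → Fin n) where
  open Game G k

  Guarded : Fin n → Set
  Guarded v = ∃ λ j → Step G (posts j) v

  guard : CopStrategy
  guard []              = posts
  guard ((C , r) ∷ _) j = if does (step? G (C j) r) then r else C j

  guard-legal : LegalCop guard
  guard-legal _ C r j = pounce-or-wait (step? G (C j) r)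
    where
      pounce-or-wait : ∀ {c} (d : Dec (Step G c r)) → Step G c (if does d then r else c)
      pounce-or-wait (yes s) = s
      pounce-or-wait (no _)  = inj₁ refl

  module _ (τ : RobberStrategy) where

    pounces : ∀ i j → Step G (cops guard τ i j) (robber guard τ i) → CaughtAt guard τ (suc i)
    pounces i j s =
      inj₁ (j , cong (λ b → if b then robber guard τ i else cops guard τ i j) (dec-true (step? G _ _) s))

    waits : ∀ i j → ¬ Step G (cops guard τ i j) (robber guard τ i) →
            cops guard τ (suc i) j ≡ cops guard τ i j
    waits i j ¬s = cong (λ b → if b then robber guard τ i else cops guard τ i j) (dec-false (step? G _ _) ¬s)

  capture-in-one : (∀ v → Guarded v) → CaptWithin 1
  capture-in-one guarded = guard , guard-legal , λ τ _ →
    let j , s = guarded (robber guard τ 0) in 1 , ≤-refl , pounces τ 0 j s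

  module Pinned (frontier : ∀ v → Guarded v ⊎ (∀ w → Edge G v w → Guarded w))
                (τ : RobberStrategy) (τ-legal : LegalRobber τ) where

    Uncaught : ℕ → Set
    Uncaught i = ∀ j → j ≤ i → ¬ CaughtAt guard τ j

    r₀ : Fin n
    r₀ = robber guard τ 0

    r₀-unguarded : Uncaught 1 → ¬ Guarded r₀
    r₀-unguarded nc (j , s) = nc 1 ≤-refl (pounces τ 0 j s)

    -- an unguarded robber cannot leave: every neighbour of his vertex is guarded
    pinned : ∀ i → Uncaught (suc i) → robber guard τ i ≡ r₀ × (∀ j → cops guard τ i j ≡ posts j)
    pinned zero    _  = refl , λ _ → refl
    pinned (suc i) nc with pinned i (λ j j≤ → nc j (m≤n⇒m≤1+n j≤))
    ... | home , posted = moved (τ-legal (run guard τ i) (cops guard τ i) (robber guard τ i) (cops guard τ (suc i)))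
      where
        unguarded : ¬ Guarded r₀
        unguarded = r₀-unguarded λ j j≤1 → nc j (≤-trans j≤1 (s≤s z≤n))

        posted′ : ∀ j → cops guard τ (suc i) j ≡ posts j
        posted′ j = trans (waits τ i j λ s → unguarded (j , subst₂ (Step G) (posted j) home s)) (posted j)

        moved : Step G (robber guard τ i) (robber guard τ (suc i)) →
                robber guard τ (suc i) ≡ r₀ × (∀ j → cops guard τ (suc i) j ≡ posts j)
        moved (inj₁ stay) = trans (sym stay) home , posted′
        moved (inj₂ edge) with frontier r₀
        ... | inj₁ guarded = ⊥-elim (unguarded guarded)
        ... | inj₂ around with around _ (subst (λ x → Edge G x (robber guard τ (suc i))) home edge)
        ...   | j , s = ⊥-elim (nc (suc (suc i)) ≤-refl (pounces τ (suc i) j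
                          (subst (λ x → Step G x (robber guard τ (suc i))) (sym (posted′ j)) s)))

  damage-at-most-one : (∀ v → Guarded v ⊎ (∀ w → Edge G v w → Guarded w)) → DmgAtMost 1
  damage-at-most-one frontier = guard , guard-legal , λ τ τ-legal →
    let open Pinned frontier τ τ-legal in
    ⁅ r₀ ⁆ , ≤-reflexive (∣⁅x⁆∣≡1 r₀) ,
    λ { _ (i , refl , nc) → subst (_∈ₛ ⁅ r₀ ⁆) (sym (proj₁ (pinned i nc))) (x∈⁅x⁆ r₀) }

module Lookahead {n : ℕ} (G : Graph n)
                 (reach : Fin n → List (Fin n)) (step⇒∈reach : ∀ {u v} → Step G u v → v ∈ reach u)
                 (k : ℕ)
                 (moves : Fin n → List (Fin n)) (∈moves⇒step : ∀ {r r′} → r′ ∈ moves r → Step G r r′)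
  where
  open import Data.List.Membership.DecPropositional (_≟_ {n}) using (_∈?_)
  open Game G k
  open GameFacts G k

  outOfReach : List (Fin n) → Fin n → Bool
  outOfReach cs r = all (λ c → not ⌊ r ∈? reach c ⌋) cs

  -- the robber at r, with cops at cs about to move, stays out of reach for m more rounds
  evades : ℕ → List (Fin n) → Fin n → Bool
  evades zero    cs r = outOfReach cs r
  evades (suc m) cs r = outOfReach cs r ∧ allChoices (map reach cs) (λ cs′ → any (evades m cs′) (moves r))

  evadesFromStart : ℕ → Bool
  evadesFromStart m = allChoices (tabulate λ (_ : Fin k) → allFin n) (λ cs → any (evades m cs) (allFin n))

  evades⇒outOfReach : ∀ m {cs r} → T (evades m cs r) → T (outOfReach cs r)
  evades⇒outOfReach zero    h = h
  evades⇒outOfReach (suc m) h = proj₁ (Equivalence.to T-∧ h)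

  outOfReach⇒unreachable : ∀ {C C′ : Conf} {r} → T (outOfReach (tabulate C) r) →
                           (∀ j → Step G (C j) (C′ j)) → ¬ ∃ λ j → C′ j ≡ r
  outOfReach⇒unreachable {C} {C′} h steps (j , refl) =
    toWitnessFalse {a? = C′ j ∈? reach (C j)} (All.tabulate⁻ (All.all⁺ _ _ h) j) (step⇒∈reach (steps j))

  evades-responses : ∀ {b} {C C′ : Conf} {r} → T (evades (suc b) (tabulate C) r) →
                     (∀ j → Step G (C j) (C′ j)) → T (any (evades b (tabulate C′)) (moves r))
  evades-responses {C = C} {C′} h steps =
    allChoices-sound _ (proj₂ (Equivalence.to T-∧ h))
      (subst (Pointwise _∈_ (tabulate C′)) (sym (map-tabulate C reach)) (tabulate⁺ (step⇒∈reach ∘ steps)))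

  evadesFromStart-sound : ∀ {m} → T (evadesFromStart m) → (C : Conf) → ∃ λ r → T (evades m (tabulate C) r)
  evadesFromStart-sound {m} h C
    with any-witness (evades m (tabulate C)) (allFin n)
           (allChoices-sound (λ cs → any (evades m cs) (allFin n)) h (tabulate⁺ (∈-allFin ∘ C)))
  ... | r , _ , e = r , e

  module Strategy (m : ℕ) (start : T (evadesFromStart m)) where

    advance : (budget : ℕ) → Fin n → Conf → Fin n
    advance zero    r _  = r
    advance (suc b) r C′ = firstOr r (evades b (tabulate C′)) (moves r)

    τ : RobberStrategy
    τ []            C  = proj₁ (evadesFromStart-sound {m} start C)
    τ ((_ , r) ∷ h) C′ = advance (m ∸ length h) r C′

    τ-legal : LegalRobber τ
    τ-legal h _ r C′ = advance-legal (m ∸ length h)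
      where
        advance-legal : ∀ b → Step G r (advance b r C′)
        advance-legal zero    = inj₁ refl
        advance-legal (suc b) with firstOr-∈⊎≡ r (evades b (tabulate C′)) (moves r)
        ... | inj₁ r′∈ = ∈moves⇒step r′∈
        ... | inj₂ ≡r  = inj₁ (sym ≡r)

    module _ (σ : CopStrategy) (σ-legal : LegalCop σ) where

      cop-steps : ∀ i j → Step G (cops σ τ i j) (cops σ τ (suc i) j)
      cop-steps i = σ-legal (run σ τ i) (cops σ τ i) (robber σ τ i)

      robber-advances : ∀ i {b} → m ∸ i ≡ b → robber σ τ (suc i) ≡ advance b (robber σ τ i) (cops σ τ (suc i))
      robber-advances i refl = cong (λ l → advance (m ∸ l) (robber σ τ i) (cops σ τ (suc i))) (length-run σ τ i)

      advances : ∀ i {b} → i + suc b ≡ m → T (evades (suc b) (tabulate (cops σ τ i)) (robber σ τ i)) →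
                 robber σ τ (suc i) ∈ moves (robber σ τ i) ×
                 T (evades b (tabulate (cops σ τ (suc i))) (robber σ τ (suc i)))
      advances i {b} i+1+b≡m h
        rewrite robber-advances i (trans (cong (_∸ i) (sym i+1+b≡m)) (m+n∸m≡n i (suc b)))
        = firstOr-∈ (robber σ τ i) (evades b (tabulate (cops σ τ (suc i)))) (moves (robber σ τ i))
            (evades-responses {b} h (cop-steps i))

      evading : ∀ i {b} → i + b ≡ m → T (evades b (tabulate (cops σ τ i)) (robber σ τ i))
      evading zero    refl  = proj₂ (evadesFromStart-sound {m} start (cops σ τ 0))
      evading (suc i) {b} e = proj₂ (advances i i+1+b≡m (evading i i+1+b≡m))
        where i+1+b≡m = trans (+-suc i b) e

      safe : ∀ i → i ≤ m → T (outOfReach (tabulate (cops σ τ i)) (robber σ τ i))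
      safe i i≤m = evades⇒outOfReach (m ∸ i) (evading i (m+[n∸m]≡n i≤m))

      uncaught : ∀ i → i ≤ suc m → ¬ CaughtAt σ τ i
      uncaught zero    _         = outOfReach⇒unreachable (safe 0 z≤n) λ _ → inj₁ refl
      uncaught (suc i) (s≤s i≤m) (inj₁ onto) = outOfReach⇒unreachable (safe i i≤m) (cop-steps i) onto
      uncaught (suc i) (s≤s i≤m) (inj₂ into) with m≤n⇒m<n∨m≡n i≤m
      ... | inj₁ i<m  = outOfReach⇒unreachable (safe (suc i) i<m) (λ _ → inj₁ refl) into
      -- once the budget is spent the robber stays put
      ... | inj₂ refl = outOfReach⇒unreachable (safe i i≤m) (cop-steps i)
                          (subst (λ r → ∃ λ j → cops σ τ (suc i) j ≡ r) (robber-advances i (n∸n≡0 m)) into)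

      follows-moves : ∀ i {b} → i + suc b ≡ m → robber σ τ (suc i) ∈ moves (robber σ τ i)
      follows-moves i e = proj₁ (advances i e (evading i e))

    survives : Survives τ (suc m)
    survives = uncaught

  can-survive : ∀ {m} → T (evadesFromStart m) → CanSurvive (suc m)
  can-survive {m} start = τ , τ-legal , survives
    where open Strategy m start

adjacencyTable : Vec (List (Fin 14)) 14
adjacencyTable =
  (# 2 ∷ # 3 ∷ # 4 ∷ # 5 ∷ []) ∷
  (# 6 ∷ # 7 ∷ # 8 ∷ # 9 ∷ []) ∷
  (# 0 ∷ # 12 ∷ []) ∷
  (# 0 ∷ # 11 ∷ []) ∷
  (# 0 ∷ []) ∷
  (# 0 ∷ # 12 ∷ []) ∷
  (# 1 ∷ # 10 ∷ # 13 ∷ []) ∷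
  (# 1 ∷ # 11 ∷ []) ∷
  (# 1 ∷ []) ∷
  (# 1 ∷ # 10 ∷ # 13 ∷ []) ∷
  (# 6 ∷ # 9 ∷ []) ∷
  (# 3 ∷ # 7 ∷ []) ∷
  (# 2 ∷ # 5 ∷ []) ∷
  (# 6 ∷ # 9 ∷ []) ∷ []

nbrs : Fin 14 → List (Fin 14)
nbrs = lookup adjacencyTable

open AdjacencyList nbrs
  using (adjacent; ∈⇒adjacent; adjacent⇒∈; symmetric?-sound; irreflexive?-sound; reaches; reaches-sound)

G : Graph 14
G = record { adj = adjacent ; sym = symmetric?-sound _ ; irrefl = irreflexive?-sound _ }

G-connected : Connected G
G-connected = connected-via G (# 0) λ u → reaches-sound 6 u (# 0) (all-allFin (λ u → reaches 6 u (# 0)) _ u)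

N[_] : Fin 14 → List (Fin 14)
N[ v ] = v ∷ nbrs v

∈nbrs⇒edge : ∀ {u v} → v ∈ nbrs u → Edge G u v
∈nbrs⇒edge {u} = ∈⇒adjacent {u}

∈nbrs⇒step : ∀ {u v} → v ∈ nbrs u → Step G u v
∈nbrs⇒step {u} v∈ = inj₂ (∈nbrs⇒edge {u} v∈)

step⇒∈N : ∀ {u v} → Step G u v → v ∈ N[ u ]
step⇒∈N     (inj₁ refl) = here refl
step⇒∈N {u} (inj₂ e)    = there (adjacent⇒∈ {u} e)

∈N⇒step : ∀ {u v} → v ∈ N[ u ] → Step G u v
∈N⇒step (here refl) = inj₁ refl
∈N⇒step (there v∈)  = ∈nbrs⇒step v∈

open GameFacts G using (capt-lower-bound; survives⇒damaged; survives-round-zero)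

module Evasion (k : ℕ) = Lookahead G N[_] step⇒∈N k N[_] ∈N⇒step
module RestlessEvasion = Lookahead G N[_] step⇒∈N 1 nbrs ∈nbrs⇒step

dominatingPosts : Fin 5 → Fin 14
dominatingPosts = lookup (# 0 ∷ # 1 ∷ # 2 ∷ # 3 ∷ # 6 ∷ [])

capture-upper : Game.CaptWithin G 5 1
capture-upper =
  Guards.capture-in-one G dominatingPosts (from-yes (all? λ v → any? λ j → step? G (dominatingPosts j) v))

capture-lower : ∀ k t → 1 ≤ k → Game.CaptWithin G k t → 6 ≤ k + t
capture-lower 1 t _ c = +-monoʳ-≤ 1 (capt-lower-bound 1 (Evasion.can-survive 1 {3} _) c)
capture-lower 2 t _ c = +-monoʳ-≤ 2 (capt-lower-bound 2 (Evasion.can-survive 2 {2} _) c)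
capture-lower 3 t _ c = +-monoʳ-≤ 3 (capt-lower-bound 3 (Evasion.can-survive 3 {1} _) c)
capture-lower 4 t _ c = +-monoʳ-≤ 4 (capt-lower-bound 4 (Evasion.can-survive 4 {0} _) c)
capture-lower 5 t _ c = +-monoʳ-≤ 5 (capt-lower-bound 5 (survives-round-zero 5 (from-yes (5 <? 14))) c)
capture-lower (suc (suc (suc (suc (suc (suc k)))))) t _ _ = m≤m+n 6 (k + t)

throttleC : IsThrottleC G 6
throttleC = (5 , s≤s z≤n , from-yes (5 ≤? 14) , 1 , capture-upper , refl) , λ k t 1≤k _ → capture-lower k t 1≤k

hubs : Fin 2 → Fin 14
hubs = lookup (# 0 ∷ # 1 ∷ [])

damage-upper : Game.DmgAtMost G 2 1
damage-upper = Guards.damage-at-most-one G hubs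
  (from-yes (all? λ v → guarded? v ⊎-dec all? λ w → edge? G v w →-dec guarded? w))
  where guarded? = λ v → any? λ j → step? G (hubs j) v

one-cop-damage : ∀ {d} → Game.DmgAtMost G 1 d → 2 ≤ d
one-cop-damage (σ , σ-legal , bound) =
  let S , ∣S∣≤d , covers = bound τ τ-legal
      damaged = survives⇒damaged 1 survives σ σ-legal
      r₀≢r₁ = edge⇒≢ G (∈nbrs⇒edge {robber σ τ 0} (follows-moves σ σ-legal 0 refl))
  in ≤-trans (x∈p∧y∈p∧x≢y⇒1<∣p∣ (covers _ (damaged 0 z≤n)) (covers _ (damaged 1 ≤-refl)) r₀≢r₁)
             ∣S∣≤d
  where open Game G 1
        open RestlessEvasion.Strategy 1 _

two-cops-damage : ∀ {d} → Game.DmgAtMost G 2 d → 1 ≤ d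
two-cops-damage (σ , σ-legal , bound) =
  let S , ∣S∣≤d , covers = bound τ τ-legal
  in ≤-trans (x∈p⇒0<∣p∣ (covers _ (survives⇒damaged 2 survives σ σ-legal 0 z≤n))) ∣S∣≤d
  where open Evasion.Strategy 2 0 _

damage-lower : ∀ k d → 1 ≤ k → Game.DmgAtMost G k d → 3 ≤ k + d
damage-lower 1 d _ dmg = s≤s (one-cop-damage dmg)
damage-lower 2 d _ dmg = s≤s (s≤s (two-cops-damage dmg))
damage-lower (suc (suc (suc k))) d _ _ = m≤m+n 3 (k + d)

throttleD : IsThrottleD G 3
throttleD = (2 , s≤s z≤n , from-yes (2 ≤? 14) , 1 , damage-upper , refl) , λ k d 1≤k _ → damage-lower k d 1≤k

theorem3p7 : ∃ λ n → Σ (Graph n) λ G → Connected G ×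
    ∃ λ a → ∃ λ b → IsThrottleD G a × IsThrottleC G b × a + 3 ≤ b
theorem3p7 = 14 , G , G-connected , 3 , 6 , throttleD , throttleC , ≤-refl
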